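{- Let $2k+1$ be a prime and let $G$ and $H$ be finite simple graphs. If both $G$ and $H$ admit a $(2k+1)$-neighborhood balanced coloring, then so does the cartesian product $G\square H$.
   Context: For a prime $2k+1$ (with $k\ge 1$), a $(2k+1)$-neighborhood balanced coloring of a finite simple graph is an assignment to each vertex of one of $2k+1$ colors $R_1,\dots,R_{2k+1}$ such that every vertex has an equal number of neighbors of each color. The cartesian product $G\square H$ has vertex set $V(G)\times V(H)$, with $(u,v)$ and $(u',v')$ adjacent if and only if either $u=u'$ and $vv'\in E(H)$, or $v=v'$ and $uu'\in E(G)$. -}

module Defs where

open import Data.Nat using (ℕ; zero; suc; _+_; _*_)
open import Data.Fin using (Fin; zero; suc; remQuot)
open import Data.Product using (_×_; _,_; Σ)
open import Data.Sum using (_⊎_)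
open import Relation.Binary.PropositionalEquality using (_≡_)
open import Relation.Nullary using (Dec; yes; no; ¬_)
open import Relation.Nullary.Decidable using (_×-dec_; _⊎-dec_)
open import Data.Fin using (_≟_)

record Graph (n : ℕ) : Set₁ where
  field
    Adj   : Fin n → Fin n → Set
    adj?  : ∀ u v → Dec (Adj u v)
    irrefl : ∀ v → ¬ Adj v v
    sym   : ∀ {u v} → Adj u v → Adj v u
open Graph public

count : ∀ {n} {P : Fin n → Set} → (∀ i → Dec (P i)) → ℕ
count {zero}  p = 0
count {suc n} p with p zero
... | yes _ = suc (count (λ i → p (suc i)))
... | no _  = count (λ i → p (suc i))

nbrCount : ∀ {n r} (G : Graph n) (col : Fin n → Fin r) → Fin n → Fin r → ℕ
nbrCount G col v c = count (λ u → adj? G v u ×-dec (col u ≟ c))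

IsNBC : ∀ {n} (r : ℕ) (G : Graph n) (col : Fin n → Fin r) → Set
IsNBC r G col = ∀ v c c' → nbrCount G col v c ≡ nbrCount G col v c'

HasNBC : ∀ {n} (r : ℕ) (G : Graph n) → Set
HasNBC {n} r G = Σ (Fin n → Fin r) (λ col → IsNBC r G col)

-- Cartesian product G □ H on vertex set Fin (n * m), where vertex x
-- corresponds to the pair remQuot {n} m x ∈ Fin n × Fin m (a bijection).
module _ {n m : ℕ} (G : Graph n) (H : Graph m) where
  private
    fstV : Fin (n * m) → Fin n
    fstV x with remQuot {n} m x
    ... | a , _ = a
    sndV : Fin (n * m) → Fin m
    sndV x with remQuot {n} m x
    ... | _ , b = b

  □Adj : Fin (n * m) → Fin (n * m) → Set
  □Adj x y = (fstV x ≡ fstV y × Adj H (sndV x) (sndV y))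
           ⊎ (sndV x ≡ sndV y × Adj G (fstV x) (fstV y))

  _□_ : Graph (n * m)
  _□_ = record
    { Adj = □Adj
    ; adj? = λ x y → ((fstV x ≟ fstV y) ×-dec adj? H (sndV x) (sndV y))
                     ⊎-dec ((sndV x ≟ sndV y) ×-dec adj? G (fstV x) (fstV y))
    ; irrefl = irr
    ; sym = sy
    }
    where
    open import Data.Sum using (inj₁; inj₂)
    import Relation.Binary.PropositionalEquality as Eq
    irr : ∀ v → ¬ □Adj v v
    irr v (inj₁ (_ , a)) = irrefl H _ a
    irr v (inj₂ (_ , a)) = irrefl G _ a
    sy : ∀ {u v} → □Adj u v → □Adj v u
    sy (inj₁ (e , a)) = inj₁ (Eq.sym e , Graph.sym H a)
    sy (inj₂ (e , a)) = inj₂ (Eq.sym e , Graph.sym G a)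

-- Colour the vertex (a , b) of G □ H by cG a + cH b, addition taken modulo the
-- number r of colours (any Latin square on the colours would do). A neighbour of
-- (a₀ , b₀) either has the form (a₀ , b) with b a neighbour of b₀ in H, and then
-- it has colour c iff cH b = c − cG a₀, or the form (a , b₀) with a a neighbour
-- of a₀ in G, and then it has colour c iff cG a = c − cH b₀. Hence the number of
-- its neighbours of colour c is a number of H-neighbours of one colour plus a
-- number of G-neighbours of one colour, and both are independent of c.
module Submission where

open import Defs hiding (sym)
open import Algebra.Core using (Op₂)
open import Algebra.Definitions using (LeftDivides; RightDivides)
open import Data.Bool using (Bool; true; false; _∧_)
open import Data.Empty using (⊥)
open import Data.Fin using (Fin; zero; suc; toℕ; fromℕ<; combine; quotient; remainder; _↑ˡ_; _↑ʳ_; _≟_)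
open import Data.Fin.Properties using (toℕ-fromℕ<; toℕ-injective; toℕ<n; remQuot-combine)
open import Data.Nat using (ℕ; zero; suc; _+_; _*_; _∸_; _%_; _≤_; NonZero)
open import Data.Nat.DivMod using (m%n<n; %-distribˡ-+; m%n%n≡m%n; [m+n]%n≡m%n; m<n⇒m%n≡m)
open import Data.Nat.Primality using (Prime)
open import Data.Nat.Properties using (+-*-semiring; +-comm; +-assoc; +-identityʳ; m+[n∸m]≡n; <⇒≤)
open import Algebra.Properties.Semiring.Sum +-*-semiring
  using (sum-syntax; sum-cong-≗; ∑-distrib-+; *-distribˡ-sum; sum-replicate-zero)
open import Data.Product using (_×_; _,_)
open import Data.Sum using (_⊎_; inj₁; inj₂)
open import Function using (_∘_; const; _⇔_; mk⇔; Equivalence)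
open import Function.Construct.Composition using (_⇔-∘_)
open import Relation.Nullary using (Dec; yes; no; does; contradiction)
open import Relation.Nullary.Decidable using (_×-dec_; _⊎-dec_)
open import Relation.Binary.PropositionalEquality
  using (_≡_; refl; sym; trans; cong; cong₂; subst; module ≡-Reasoning)
open ≡-Reasoning

fromBool : Bool → ℕ
fromBool true  = 1
fromBool false = 0

𝟙 : ∀ {p} {P : Set p} → Dec P → ℕ
𝟙 d = fromBool (does d)

𝟙-cong : ∀ {P Q : Set} → P ⇔ Q → (d : Dec P) (e : Dec Q) → 𝟙 d ≡ 𝟙 e
𝟙-cong _   (yes _) (yes _) = refl
𝟙-cong _   (no _)  (no _)  = refl
𝟙-cong P⇔Q (yes p) (no ¬q) = contradiction (Equivalence.to P⇔Q p) ¬q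
𝟙-cong P⇔Q (no ¬p) (yes q) = contradiction (Equivalence.from P⇔Q q) ¬p

𝟙-× : ∀ {P Q : Set} (d : Dec P) (e : Dec Q) → 𝟙 (d ×-dec e) ≡ 𝟙 d * 𝟙 e
𝟙-× d e = fromBool-∧ (does d) (does e)
  where
  fromBool-∧ : ∀ x y → fromBool (x ∧ y) ≡ fromBool x * fromBool y
  fromBool-∧ true  true  = refl
  fromBool-∧ true  false = refl
  fromBool-∧ false _     = refl

𝟙-⊎ : ∀ {P Q : Set} → (P → Q → ⊥) → (d : Dec P) (e : Dec Q) → 𝟙 (d ⊎-dec e) ≡ 𝟙 d + 𝟙 e
𝟙-⊎ disjoint (yes p) (yes q) = contradiction q (disjoint p)
𝟙-⊎ disjoint (yes _) (no _)  = refl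
𝟙-⊎ disjoint (no _)  (yes _) = refl
𝟙-⊎ disjoint (no _)  (no _)  = refl

count≡∑𝟙 : ∀ {n} {P : Fin n → Set} (p : ∀ i → Dec (P i)) → count p ≡ ∑[ i < n ] 𝟙 (p i)
count≡∑𝟙 {zero}  p = refl
count≡∑𝟙 {suc n} p with p zero
... | yes _ = cong suc (count≡∑𝟙 (p ∘ suc))
... | no _  = count≡∑𝟙 (p ∘ suc)

∑-𝟙≡* : ∀ {n} (i₀ : Fin n) (f : Fin n → ℕ) → ∑[ i < n ] (𝟙 (i₀ ≟ i) * f i) ≡ f i₀
∑-𝟙≡* {suc n} zero    f = begin
  f zero + 0 + ∑[ i < n ] 0  ≡⟨ cong₂ _+_ (+-identityʳ (f zero)) (sum-replicate-zero n) ⟩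
  f zero + 0                 ≡⟨ +-identityʳ (f zero) ⟩
  f zero                     ∎
∑-𝟙≡* {suc n} (suc i₀) f = ∑-𝟙≡* i₀ (f ∘ suc)

∑-↑ : ∀ {m n} (f : Fin (m + n) → ℕ) → ∑[ k < m + n ] f k ≡ ∑[ i < m ] f (i ↑ˡ n) + ∑[ j < n ] f (m ↑ʳ j)
∑-↑ {zero}          f = refl
∑-↑ {suc m} {n} f = begin
  f zero + ∑[ i < m + n ] f (suc i)
    ≡⟨ cong (f zero +_) (∑-↑ {m} {n} (f ∘ suc)) ⟩
  f zero + (∑[ i < m ] f (suc (i ↑ˡ n)) + ∑[ j < n ] f (suc (m ↑ʳ j)))
    ≡⟨ +-assoc (f zero) _ _ ⟨
  f zero + ∑[ i < m ] f (suc (i ↑ˡ n)) + ∑[ j < n ] f (suc (m ↑ʳ j)) ∎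

∑-combine : ∀ {m n} (f : Fin (m * n) → ℕ) → ∑[ k < m * n ] f k ≡ ∑[ i < m ] ∑[ j < n ] f (combine i j)
∑-combine {zero}      f = refl
∑-combine {suc m} {n} f =
  trans (∑-↑ {n} f) (cong (∑[ j < n ] f (j ↑ˡ m * n) +_) (∑-combine {m} (f ∘ (n ↑ʳ_))))

-- Counting over the neighbourhood {i₀} × N(j₀) ⊎ N(i₀) × {j₀} of (i₀ , j₀) in a cartesian product.
∑∑-cross : ∀ {m n} (i₀ : Fin m) (j₀ : Fin n) (f : Fin n → ℕ) (g : Fin m → ℕ) →
  ∑[ i < m ] ∑[ j < n ] (𝟙 (i₀ ≟ i) * f j + 𝟙 (j₀ ≟ j) * g i) ≡ ∑[ j < n ] f j + ∑[ i < m ] g i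
∑∑-cross {m} {n} i₀ j₀ f g = begin
  ∑[ i < m ] ∑[ j < n ] (𝟙 (i₀ ≟ i) * f j + 𝟙 (j₀ ≟ j) * g i)
    ≡⟨ sum-cong-≗ (λ i → ∑-distrib-+ (λ j → 𝟙 (i₀ ≟ i) * f j) (λ j → 𝟙 (j₀ ≟ j) * g i)) ⟩
  ∑[ i < m ] (∑[ j < n ] (𝟙 (i₀ ≟ i) * f j) + ∑[ j < n ] (𝟙 (j₀ ≟ j) * g i))
    ≡⟨ ∑-distrib-+ {m} _ _ ⟩
  ∑[ i < m ] ∑[ j < n ] (𝟙 (i₀ ≟ i) * f j) + ∑[ i < m ] ∑[ j < n ] (𝟙 (j₀ ≟ j) * g i)
    ≡⟨ cong₂ _+_ (sym (sum-cong-≗ (λ i → *-distribˡ-sum (𝟙 (i₀ ≟ i)) f)))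
                 (sum-cong-≗ (λ i → ∑-𝟙≡* j₀ (const (g i)))) ⟩
  ∑[ i < m ] (𝟙 (i₀ ≟ i) * ∑[ j < n ] f j) + ∑[ i < m ] g i
    ≡⟨ cong (_+ ∑[ i < m ] g i) (∑-𝟙≡* i₀ (const (∑[ j < n ] f j))) ⟩
  ∑[ j < n ] f j + ∑[ i < m ] g i ∎

∙≡⇔≡\\ : ∀ {A : Set} {_∙_ _\\_ : Op₂ A} → LeftDivides _≡_ _∙_ _\\_ →
         ∀ {x y z} → (x ∙ y ≡ z) ⇔ (y ≡ x \\ z)
∙≡⇔≡\\ (divˡ , divʳ) {x} {y} = mk⇔ (λ { refl → sym (divʳ x y) }) (λ { refl → divˡ x _ })

∙≡⇔≡// : ∀ {A : Set} {_∙_ _//_ : Op₂ A} → RightDivides _≡_ _∙_ _//_ →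
         ∀ {x y z} → (x ∙ y ≡ z) ⇔ (x ≡ z // y)
∙≡⇔≡// (divˡ , divʳ) {x} {y} = mk⇔ (λ { refl → sym (divʳ y x) }) (λ { refl → divˡ y _ })

module _ {r : ℕ} .{{_ : NonZero r}} where
  [m+n%r]%r≡[m+n]%r : ∀ m n → (m + n % r) % r ≡ (m + n) % r
  [m+n%r]%r≡[m+n]%r m n = begin
    (m + n % r) % r         ≡⟨ %-distribˡ-+ m (n % r) r ⟩
    (m % r + n % r % r) % r ≡⟨ cong (λ k → (m % r + k) % r) (m%n%n≡m%n n r) ⟩
    (m % r + n % r) % r     ≡⟨ %-distribˡ-+ m n r ⟨
    (m + n) % r             ∎

  [m%r+n]%r≡[m+n]%r : ∀ m n → (m % r + n) % r ≡ (m + n) % r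
  [m%r+n]%r≡[m+n]%r m n = begin
    (m % r + n) % r ≡⟨ cong (_% r) (+-comm (m % r) n) ⟩
    (n + m % r) % r ≡⟨ [m+n%r]%r≡[m+n]%r n m ⟩
    (n + m) % r     ≡⟨ cong (_% r) (+-comm n m) ⟩
    (m + n) % r     ∎

  [i+n+[r∸i]]%r≡n%r : ∀ i n → i ≤ r → (i + n + (r ∸ i)) % r ≡ n % r
  [i+n+[r∸i]]%r≡n%r i n i≤r = begin
    (i + n + (r ∸ i)) % r   ≡⟨ cong (λ k → (k + (r ∸ i)) % r) (+-comm i n) ⟩
    (n + i + (r ∸ i)) % r   ≡⟨ cong (_% r) (+-assoc n i (r ∸ i)) ⟩
    (n + (i + (r ∸ i))) % r ≡⟨ cong (λ k → (n + k) % r) (m+[n∸m]≡n i≤r) ⟩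
    (n + r) % r             ≡⟨ [m+n]%n≡m%n n r ⟩
    n % r                   ∎

  _+ₘ_ : Op₂ (Fin r)
  i +ₘ j = fromℕ< (m%n<n (toℕ i + toℕ j) r)

  -- k − i modulo r, computed as k + (r − i) to avoid truncated subtraction.
  _\\ₘ_ : Op₂ (Fin r)
  i \\ₘ k = fromℕ< (m%n<n (toℕ k + (r ∸ toℕ i)) r)

  _//ₘ_ : Op₂ (Fin r)
  k //ₘ j = j \\ₘ k

  toℕ%r : ∀ (i : Fin r) → toℕ i % r ≡ toℕ i
  toℕ%r i = m<n⇒m%n≡m (toℕ<n i)

  +ₘ-comm : ∀ i j → i +ₘ j ≡ j +ₘ i
  +ₘ-comm i j = toℕ-injective (begin
    toℕ (i +ₘ j)            ≡⟨ toℕ-fromℕ< _ ⟩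
    (toℕ i + toℕ j) % r     ≡⟨ cong (_% r) (+-comm (toℕ i) (toℕ j)) ⟩
    (toℕ j + toℕ i) % r     ≡⟨ toℕ-fromℕ< _ ⟨
    toℕ (j +ₘ i)            ∎)

  +ₘ-\\ₘ : ∀ i k → i +ₘ (i \\ₘ k) ≡ k
  +ₘ-\\ₘ i k = toℕ-injective (begin
    toℕ (i +ₘ (i \\ₘ k))                      ≡⟨ toℕ-fromℕ< _ ⟩
    (toℕ i + toℕ (i \\ₘ k)) % r               ≡⟨ cong (λ n → (toℕ i + n) % r) (toℕ-fromℕ< _) ⟩
    (toℕ i + (toℕ k + (r ∸ toℕ i)) % r) % r   ≡⟨ [m+n%r]%r≡[m+n]%r (toℕ i) _ ⟩
    (toℕ i + (toℕ k + (r ∸ toℕ i))) % r       ≡⟨ cong (_% r) (+-assoc (toℕ i) (toℕ k) _) ⟨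
    (toℕ i + toℕ k + (r ∸ toℕ i)) % r         ≡⟨ [i+n+[r∸i]]%r≡n%r (toℕ i) (toℕ k) (<⇒≤ (toℕ<n i)) ⟩
    toℕ k % r                                 ≡⟨ toℕ%r k ⟩
    toℕ k                                     ∎)

  \\ₘ-+ₘ : ∀ i j → i \\ₘ (i +ₘ j) ≡ j
  \\ₘ-+ₘ i j = toℕ-injective (begin
    toℕ (i \\ₘ (i +ₘ j))                      ≡⟨ toℕ-fromℕ< _ ⟩
    (toℕ (i +ₘ j) + (r ∸ toℕ i)) % r          ≡⟨ cong (λ n → (n + (r ∸ toℕ i)) % r) (toℕ-fromℕ< _) ⟩
    ((toℕ i + toℕ j) % r + (r ∸ toℕ i)) % r   ≡⟨ [m%r+n]%r≡[m+n]%r (toℕ i + toℕ j) _ ⟩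
    (toℕ i + toℕ j + (r ∸ toℕ i)) % r         ≡⟨ [i+n+[r∸i]]%r≡n%r (toℕ i) (toℕ j) (<⇒≤ (toℕ<n i)) ⟩
    toℕ j % r                                 ≡⟨ toℕ%r j ⟩
    toℕ j                                     ∎)

  +ₘ-leftDivides : LeftDivides _≡_ _+ₘ_ _\\ₘ_
  +ₘ-leftDivides = +ₘ-\\ₘ , \\ₘ-+ₘ

  +ₘ-rightDivides : RightDivides _≡_ _+ₘ_ _//ₘ_
  +ₘ-rightDivides = (λ j k → trans (+ₘ-comm (j \\ₘ k) j) (+ₘ-\\ₘ j k))
                  , (λ j i → trans (cong (j \\ₘ_) (+ₘ-comm i j)) (\\ₘ-+ₘ j i))

module LatinSquareColouring
  {r : ℕ} (_∙_ _\\_ _//_ : Op₂ (Fin r))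
  (leftDivides : LeftDivides _≡_ _∙_ _\\_) (rightDivides : RightDivides _≡_ _∙_ _//_)
  {n m : ℕ} (G : Graph n) (H : Graph m) (colG : Fin n → Fin r) (colH : Fin m → Fin r)
  where

  colouring : Fin (n * m) → Fin r
  colouring x = colG (quotient m x) ∙ colH (remainder {n} m x)

  module _ {a₀ a : Fin n} {b₀ b : Fin m} {c : Fin r} where
    private
      solveH : (colG a₀ ∙ colH b ≡ c) ⇔ (colH b ≡ colG a₀ \\ c)
      solveH = ∙≡⇔≡\\ {_∙_ = _∙_} leftDivides
      solveG : (colG a ∙ colH b₀ ≡ c) ⇔ (colG a ≡ c // colH b₀)
      solveG = ∙≡⇔≡// {_∙_ = _∙_} rightDivides

    neighbour⇔ :
      (((a₀ ≡ a × Adj H b₀ b) ⊎ (b₀ ≡ b × Adj G a₀ a)) × colG a ∙ colH b ≡ c)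
      ⇔ ((a₀ ≡ a × Adj H b₀ b × colH b ≡ colG a₀ \\ c) ⊎ (b₀ ≡ b × Adj G a₀ a × colG a ≡ c // colH b₀))
    neighbour⇔ = mk⇔
      (λ { (inj₁ (refl , adj) , eq) → inj₁ (refl , adj , Equivalence.to solveH eq)
         ; (inj₂ (refl , adj) , eq) → inj₂ (refl , adj , Equivalence.to solveG eq) })
      (λ { (inj₁ (refl , adj , eq)) → inj₁ (refl , adj) , Equivalence.from solveH eq
         ; (inj₂ (refl , adj , eq)) → inj₂ (refl , adj) , Equivalence.from solveG eq })

  module _ (v : Fin (n * m)) (c : Fin r) where
    private
      a₀ = quotient {n} m v
      b₀ = remainder {n} m v

      ColouredNeighbour : Fin n × Fin m → Set
      ColouredNeighbour (a , b) = ((a₀ ≡ a × Adj H b₀ b) ⊎ (b₀ ≡ b × Adj G a₀ a)) × colG a ∙ colH b ≡ c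

      combine-neighbour⇔ : ∀ a b →
        (Adj (G □ H) v (combine a b) × colouring (combine a b) ≡ c) ⇔ ColouredNeighbour (a , b)
      combine-neighbour⇔ a b =
        mk⇔ (subst ColouredNeighbour (remQuot-combine {n} {m} a b)) (subst ColouredNeighbour (sym (remQuot-combine {n} {m} a b)))

      H-neighbour? : ∀ b → Dec (Adj H b₀ b × colH b ≡ colG a₀ \\ c)
      H-neighbour? b = adj? H b₀ b ×-dec (colH b ≟ colG a₀ \\ c)

      G-neighbour? : ∀ a → Dec (Adj G a₀ a × colG a ≡ c // colH b₀)
      G-neighbour? a = adj? G a₀ a ×-dec (colG a ≟ c // colH b₀)

      𝟙-neighbour : ∀ a b →
        𝟙 (adj? (G □ H) v (combine a b) ×-dec (colouring (combine a b) ≟ c))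
        ≡ 𝟙 (a₀ ≟ a) * 𝟙 (H-neighbour? b) + 𝟙 (b₀ ≟ b) * 𝟙 (G-neighbour? a)
      𝟙-neighbour a b = begin
        𝟙 □-neighbour?
          ≡⟨ 𝟙-cong (neighbour⇔ ⇔-∘ combine-neighbour⇔ a b) □-neighbour? (a₀≡a×H? ⊎-dec b₀≡b×G?) ⟩
        𝟙 (a₀≡a×H? ⊎-dec b₀≡b×G?)
          ≡⟨ 𝟙-⊎ disjoint a₀≡a×H? b₀≡b×G? ⟩
        𝟙 a₀≡a×H? + 𝟙 b₀≡b×G?
          ≡⟨ cong₂ _+_ (𝟙-× (a₀ ≟ a) (H-neighbour? b)) (𝟙-× (b₀ ≟ b) (G-neighbour? a)) ⟩
        𝟙 (a₀ ≟ a) * 𝟙 (H-neighbour? b) + 𝟙 (b₀ ≟ b) * 𝟙 (G-neighbour? a) ∎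
        where
        □-neighbour? = adj? (G □ H) v (combine a b) ×-dec (colouring (combine a b) ≟ c)
        a₀≡a×H? = (a₀ ≟ a) ×-dec H-neighbour? b
        b₀≡b×G? = (b₀ ≟ b) ×-dec G-neighbour? a
        disjoint : a₀ ≡ a × _ → b₀ ≡ b × Adj G a₀ a × _ → ⊥
        disjoint (refl , _) (_ , adj , _) = irrefl G a₀ adj

    nbrCount-□ : nbrCount (G □ H) colouring v c
               ≡ nbrCount H colH b₀ (colG a₀ \\ c) + nbrCount G colG a₀ (c // colH b₀)
    nbrCount-□ = begin
      nbrCount (G □ H) colouring v c
        ≡⟨ count≡∑𝟙 (λ x → adj? (G □ H) v x ×-dec (colouring x ≟ c)) ⟩
      ∑[ x < n * m ] 𝟙 (adj? (G □ H) v x ×-dec (colouring x ≟ c))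
        ≡⟨ ∑-combine {n} {m} _ ⟩
      ∑[ a < n ] ∑[ b < m ] 𝟙 (adj? (G □ H) v (combine a b) ×-dec (colouring (combine a b) ≟ c))
        ≡⟨ sum-cong-≗ (λ a → sum-cong-≗ (𝟙-neighbour a)) ⟩
      ∑[ a < n ] ∑[ b < m ] (𝟙 (a₀ ≟ a) * 𝟙 (H-neighbour? b) + 𝟙 (b₀ ≟ b) * 𝟙 (G-neighbour? a))
        ≡⟨ ∑∑-cross a₀ b₀ (𝟙 ∘ H-neighbour?) (𝟙 ∘ G-neighbour?) ⟩
      ∑[ b < m ] 𝟙 (H-neighbour? b) + ∑[ a < n ] 𝟙 (G-neighbour? a)
        ≡⟨ cong₂ _+_ (count≡∑𝟙 H-neighbour?) (count≡∑𝟙 G-neighbour?) ⟨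
      nbrCount H colH b₀ (colG a₀ \\ c) + nbrCount G colG a₀ (c // colH b₀) ∎

  colouring-isNBC : IsNBC r G colG → IsNBC r H colH → IsNBC r (G □ H) colouring
  colouring-isNBC balancedG balancedH v c c′ = begin
    nbrCount (G □ H) colouring v c
      ≡⟨ nbrCount-□ v c ⟩
    nbrCount H colH b₀ (colG a₀ \\ c) + nbrCount G colG a₀ (c // colH b₀)
      ≡⟨ cong₂ _+_ (balancedH b₀ _ _) (balancedG a₀ _ _) ⟩
    nbrCount H colH b₀ (colG a₀ \\ c′) + nbrCount G colG a₀ (c′ // colH b₀)
      ≡⟨ nbrCount-□ v c′ ⟨
    nbrCount (G □ H) colouring v c′ ∎
    where
    a₀ = quotient {n} m v
    b₀ = remainder {n} m v

hasNBC-□ : ∀ r {n m} (G : Graph n) (H : Graph m) → HasNBC r G → HasNBC r H → HasNBC r (G □ H)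
hasNBC-□ zero    {n} {m} G H (colG , _) _ = colG ∘ quotient {n} m , λ _ ()
hasNBC-□ (suc t) G H (colG , balancedG) (colH , balancedH) =
  colouring , colouring-isNBC balancedG balancedH
  where open LatinSquareColouring _+ₘ_ _\\ₘ_ _//ₘ_ +ₘ-leftDivides +ₘ-rightDivides G H colG colH

theorem2p11 : (k : ℕ) → Prime (2 * k + 1) → {n m : ℕ} → (G : Graph n) → (H : Graph m) →
    HasNBC (2 * k + 1) G → HasNBC (2 * k + 1) H → HasNBC (2 * k + 1) (G □ H)
theorem2p11 k _ = hasNBC-□ (2 * k + 1)
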